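{- Let $G=(X\cup Y,E)$ be a connected bipartite permutation graph with a strong ordering $(<_X,<_Y)$, where $X=\{x_1<_X\dots<_X x_p\}$ and $Y=\{y_1<_Y\dots<_Y y_q\}$. Let $u$ be an interim vertex of $G$. Then $u$ is not a cut-vertex of $G$ if and only if there exists $u_0\in N(u)$ such that $f(u_0)<u$ and $l(u_0)>u$.
   Context: A bipartite permutation graph is a graph that is both bipartite and a permutation graph (intersection graph of straight line segments joining two parallel lines). For a bipartite graph with bipartition $X,Y$, a strong ordering $(<_X,<_Y)$ consists of linear orders $<_X$ on $X$ and $<_Y$ on $Y$ such that for any edges $ab$ and $a'b'$ with $a,a'\in X$, $b,b'\in Y$, if $a<_X a'$ and $b'<_Y b$, then $ab'$ and $a'b$ are edges. For a vertex $v$, $f(v)$ is the smallest neighbour of $v$ and $l(v)$ the largest neighbour of $v$ with respect to the order on the side containing $N(v)$; comparisons $f(u_0)<u$, $l(u_0)>u$ use the order of the side containing $u$ (written $<$ for either $<_X$ or $<_Y$). The vertices $x_1,x_p,y_1,y_q$ are called extreme and all other vertices interim. -}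

module Defs where

open import Level using (0ℓ)
open import Data.Nat using (ℕ; suc) renaming (_<_ to _<ℕ_)
open import Data.Fin using (Fin; toℕ) renaming (_<_ to _<F_; _≤_ to _≤F_)
open import Data.Sum using (_⊎_; inj₁; inj₂)
open import Data.Product using (Σ; ∃; _×_; _,_)
open import Data.Empty using (⊥)
open import Relation.Nullary using (¬_)
open import Relation.Binary.PropositionalEquality using (_≡_; _≢_)
open import Relation.Binary.Construct.Closure.ReflexiveTransitive using (Star)

-- A bipartite graph with parts X = {x_1,...,x_p} (indexed by Fin p, x_{i+1} ↔ index i)
-- and Y = {y_1,...,y_q} (indexed by Fin q); the given linear orders <_X and <_Y
-- are the index orders on Fin p and Fin q.
Vertex : ℕ → ℕ → Set
Vertex p q = Fin p ⊎ Fin q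

module _ {p q : ℕ} (E : Fin p → Fin q → Set) where

  Adj : Vertex p q → Vertex p q → Set
  Adj (inj₁ x) (inj₂ y) = E x y
  Adj (inj₂ y) (inj₁ x) = E x y
  Adj (inj₁ _) (inj₁ _) = ⊥
  Adj (inj₂ _) (inj₂ _) = ⊥

  IsStrongOrdering : Set
  IsStrongOrdering = ∀ (a a' : Fin p) (b b' : Fin q) →
    E a b → E a' b' → a <F a' → b' <F b → E a b' × E a' b

  -- permutation graph: intersection graph of segments joining two parallel lines;
  -- vertex v is the segment from position top v on the upper line to position bot v
  -- on the lower line (endpoints pairwise distinct).
  IsPermutationGraph : Set
  IsPermutationGraph = Σ (Vertex p q → ℕ) λ top → Σ (Vertex p q → ℕ) λ bot →
    (∀ u v → top u ≡ top v → u ≡ v) × (∀ u v → bot u ≡ bot v → u ≡ v) ×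
    (∀ u v → u ≢ v →
       (Adj u v → (top u <ℕ top v × bot v <ℕ bot u) ⊎ (top v <ℕ top u × bot u <ℕ bot v)) ×
       ((top u <ℕ top v × bot v <ℕ bot u) ⊎ (top v <ℕ top u × bot u <ℕ bot v) → Adj u v))

  Connected : Set
  Connected = ∀ v w → Star Adj v w

  AdjWithout : Vertex p q → Vertex p q → Vertex p q → Set
  AdjWithout u a b = Adj a b × a ≢ u × b ≢ u

  IsCutVertex : Vertex p q → Set
  IsCutVertex u = ∃ λ v → ∃ λ w → v ≢ u × w ≢ u × ¬ Star (AdjWithout u) v w

  _∈N_ : Vertex p q → Vertex p q → Set
  a ∈N v = Adj v a

_<V_ : ∀ {p q} → Vertex p q → Vertex p q → Set
inj₁ a <V inj₁ b = a <F b
inj₂ a <V inj₂ b = a <F b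
_ <V _ = ⊥

_≤V_ : ∀ {p q} → Vertex p q → Vertex p q → Set
inj₁ a ≤V inj₁ b = a ≤F b
inj₂ a ≤V inj₂ b = a ≤F b
_ ≤V _ = ⊥

module _ {p q : ℕ} (E : Fin p → Fin q → Set) where

  IsFirstNbr : Vertex p q → Vertex p q → Set
  IsFirstNbr v a = Adj E v a × (∀ b → Adj E v b → a ≤V b)

  IsLastNbr : Vertex p q → Vertex p q → Set
  IsLastNbr v a = Adj E v a × (∀ b → Adj E v b → b ≤V a)

IsInterim : ∀ {p q} → Vertex p q → Set
IsInterim {p} {q} (inj₁ i) = 0 <ℕ toℕ i × suc (toℕ i) <ℕ p
IsInterim {p} {q} (inj₂ j) = 0 <ℕ toℕ j × suc (toℕ j) <ℕ q

{-# OPTIONS --safe #-}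
-- It suffices to treat an interim x_i: the Y side follows by transposing the graph.
-- If some y has neighbours x_k, x_j with k < i < j, the strong ordering forces y to be
-- adjacent to x_i, and links every other neighbour y' of x_i to y through x_k (if y' < y)
-- or x_j (if y' > y); so G − x_i stays connected, and f(y) ≤ x_k < x_i < x_j ≤ l(y).
-- If no such y exists, the vertices x < x_i together with their neighbours form a set
-- closed under adjacency in G − x_i which contains x_1 but not x_p, so x_i is a cut-vertex.
module Submission where

open import Defs
open import Level using (0ℓ)
open import Data.Nat using (ℕ; suc; z≤n; s≤s) renaming (_<_ to _<ℕ_; _<?_ to _<ℕ?_)
open import Data.Nat.Properties using (≤-reflexive; ≤-<-trans; <-≤-trans; <-asym)
open import Data.Fin using (Fin; toℕ; fromℕ<; _≟_) renaming (zero to fz; suc to fs; _<_ to _<F_; _≤_ to _≤F_; _<?_ to _<F?_)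
open import Data.Fin.Properties using (any?; <-cmp; <⇒≢; toℕ-fromℕ<)
open import Data.Product using (∃; ∃₂; _×_; _,_; proj₁; proj₂)
open import Data.Sum using (_⊎_; inj₁; inj₂; swap)
open import Data.Sum.Properties using (≡-dec; inj₁-injective; swap-involutive)
open import Function using (_∘_; id; flip)
open import Function.Bundles using (_⇔_; mk⇔; Equivalence)
open import Relation.Nullary using (¬_; Dec; yes; no; contradiction)
open import Relation.Nullary.Decidable using (_×-dec_; _⊎-dec_; map′)
open import Relation.Unary using (Pred)
open import Relation.Binary using (Rel; Decidable; tri<; tri≈; tri>)
open import Relation.Binary.PropositionalEquality using (_≡_; _≢_; ≢-sym; refl; sym; subst₂)
open import Relation.Binary.Construct.Closure.ReflexiveTransitive using (Star; ε; _◅_; _◅◅_; gmap; fold; reverse)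

Straddled : ∀ {p q} (E : Fin p → Fin q → Set) → Vertex p q → Set
Straddled E u = ∃ λ u₀ → _∈N_ E u₀ u × (∃ λ a → IsFirstNbr E u₀ a × a <V u) × (∃ λ b → IsLastNbr E u₀ b × u <V b)

least : ∀ {n} {P : Pred (Fin n) 0ℓ} → (∀ x → Dec (P x)) → ∃ P →
        ∃ λ m → P m × (∀ {j} → P j → m ≤F j)
least {suc n} P? (k , Pk) with P? fz
... | yes P0 = fz , P0 , λ _ → z≤n
least P? (fz , P0) | no ¬P0 = contradiction P0 ¬P0
least P? (fs k , Pk) | no ¬P0 with least (P? ∘ fs) (k , Pk)
... | m , Pm , m-least = fs m , Pm , λ { {fz} P0 → contradiction P0 ¬P0 ; {fs j} Pj → s≤s (m-least Pj) }

greatest : ∀ {n} {P : Pred (Fin n) 0ℓ} → (∀ x → Dec (P x)) → ∃ P →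
           ∃ λ m → P m × (∀ {j} → P j → j ≤F m)
greatest {suc n} P? (k , Pk) with any? (P? ∘ fs)
... | yes ∃Psuc with greatest (P? ∘ fs) ∃Psuc
...   | m , Pm , m-greatest = fs m , Pm , λ { {fz} _ → z≤n ; {fs j} Pj → s≤s (m-greatest Pj) }
greatest P? (fz , P0) | no ¬∃Psuc = fz , P0 , λ { {fz} _ → z≤n ; {fs j} Pj → contradiction (j , Pj) ¬∃Psuc }
greatest P? (fs k , Pk) | no ¬∃Psuc = contradiction (k , Pk) ¬∃Psuc

interim⇒between : ∀ {n} (i : Fin n) → 0 <ℕ toℕ i × suc (toℕ i) <ℕ n →
                  (∃ λ (k : Fin n) → k <F i) × (∃ λ (j : Fin n) → i <F j)
interim⇒between {suc n} (fs i) (_ , i+1<n) = (fz , s≤s z≤n) , (fromℕ< i+1<n , ≤-reflexive (sym (toℕ-fromℕ< i+1<n)))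

Star-preserves : ∀ {I : Set} {T : Rel I 0ℓ} (P : Pred I 0ℓ) → (∀ {s t} → T s t → P s → P t) →
                 ∀ {s t} → Star T s t → P s → P t
Star-preserves P step = fold (λ s t → P s → P t) (λ e k → k ∘ step e) id

module _ {p q : ℕ} (E : Fin p → Fin q → Set) where

  Adj-sym : ∀ {a b} → Adj E a b → Adj E b a
  Adj-sym {inj₁ _} {inj₂ _} e = e
  Adj-sym {inj₂ _} {inj₁ _} e = e

  AdjWithout-sym : ∀ {u a b} → AdjWithout E u a b → AdjWithout E u b a
  AdjWithout-sym {a = a} {b} (e , a≢u , b≢u) = Adj-sym {a} {b} e , b≢u , a≢u

  IsPermutationGraph⇒Decidable : IsPermutationGraph E → Decidable E
  IsPermutationGraph⇒Decidable (top , bot , _ , _ , segments) x y with segments (inj₁ x) (inj₂ y) (λ ())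
  ... | to , from = map′ from to ((top (inj₁ x) <ℕ? top (inj₂ y) ×-dec bot (inj₂ y) <ℕ? bot (inj₁ x)) ⊎-dec
                                  (top (inj₂ y) <ℕ? top (inj₁ x) ×-dec bot (inj₁ x) <ℕ? bot (inj₂ y)))

  Connected⇒neighbour : Connected E → ∀ {u v} → u ≢ v → ∃ (Adj E u)
  Connected⇒neighbour conn {u} {v} u≢v with conn u v
  ... | ε = contradiction refl u≢v
  ... | e ◅ _ = _ , e

  -- Every vertex is either u or reachable from w avoiding u: this is preserved along
  -- edges because the only way to leave u is to one of its neighbours.
  ¬cut-if-neighbours-reachable : Connected E → ∀ u w → (∀ {v} → Adj E u v → Star (AdjWithout E u) w v) →
                                 ¬ IsCutVertex E u
  ¬cut-if-neighbours-reachable conn u w reach (v , v′ , v≢u , v′≢u , ¬path) =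
    ¬path (reverse AdjWithout-sym (reachable v≢u) ◅◅ reachable v′≢u)
    where
    ReachableOrU : Pred (Vertex p q) 0ℓ
    ReachableOrU t = t ≡ u ⊎ Star (AdjWithout E u) w t

    step : ∀ {s t} → Adj E s t → ReachableOrU s → ReachableOrU t
    step {s} {t} e r with ≡-dec _≟_ _≟_ t u | ≡-dec _≟_ _≟_ s u
    ... | yes t≡u | _        = inj₁ t≡u
    ... | no t≢u  | yes refl = inj₂ (reach e)
    step e (inj₁ s≡u)  | no _   | no s≢u = contradiction s≡u s≢u
    step e (inj₂ path) | no t≢u | no s≢u = inj₂ (path ◅◅ (e , s≢u , t≢u) ◅ ε)

    reachable : ∀ {t} → t ≢ u → Star (AdjWithout E u) w t
    reachable {t} t≢u with Star-preserves ReachableOrU step (conn w t) (inj₂ ε)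
    ... | inj₁ t≡u = contradiction t≡u t≢u
    ... | inj₂ path = path

module XVertex {p q : ℕ} (E : Fin p → Fin q → Set) (i : Fin p) where

  Straddles : Fin q → Set
  Straddles y = ∃₂ λ k j → k <F i × i <F j × E k y × E j y

  Straddles? : Decidable E → ∀ y → Dec (Straddles y)
  Straddles? E? y = any? λ k → any? λ j → (k <F? i) ×-dec (i <F? j) ×-dec E? k y ×-dec E? j y

  Straddled⇒Straddles : Straddled E (inj₁ i) → ∃ Straddles
  Straddled⇒Straddles (inj₂ y , _ , (inj₁ a , (eay , _) , a<i) , (inj₁ b , (eby , _) , i<b)) =
    y , a , b , a<i , i<b , eay , eby

  module _ (so : IsStrongOrdering E) {y : Fin q} where

    Straddles⇒adjacent : Straddles y → ∀ {y′} → E i y′ → E i y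
    Straddles⇒adjacent (k , j , k<i , i<j , eky , ejy) {y′} eiy′ with <-cmp y′ y
    ... | tri< y′<y _ _ = proj₂ (so k i y y′ eky eiy′ k<i y′<y)
    ... | tri≈ _ refl _ = eiy′
    ... | tri> _ _ y<y′ = proj₁ (so i j y′ y eiy′ ejy i<j y<y′)

    Straddles⇒neighbours-reachable : Straddles y → ∀ {v} → Adj E (inj₁ i) v →
                                     Star (AdjWithout E (inj₁ i)) (inj₂ y) v
    Straddles⇒neighbours-reachable (k , j , k<i , i<j , eky , ejy) {inj₂ y′} eiy′ with <-cmp y′ y
    ... | tri< y′<y _ _ = (eky , (λ ()) , k≢i) ◅ (proj₁ (so k i y y′ eky eiy′ k<i y′<y) , k≢i , (λ ())) ◅ ε
      where k≢i = <⇒≢ k<i ∘ inj₁-injective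
    ... | tri≈ _ refl _ = ε
    ... | tri> _ _ y<y′ = (ejy , (λ ()) , j≢i) ◅ (proj₂ (so i j y′ y eiy′ ejy i<j y<y′) , j≢i , (λ ())) ◅ ε
      where j≢i = ≢-sym (<⇒≢ i<j ∘ inj₁-injective)

    Straddles⇒Straddled : Decidable E → ∃ (E i) → Straddles y → Straddled E (inj₁ i)
    Straddles⇒Straddled E? (_ , eiy′) s@(k , j , k<i , i<j , eky , ejy)
      with least (λ x → E? x y) (k , eky) | greatest (λ x → E? x y) (j , ejy)
    ... | m , emy , m-least | M , eMy , M-greatest =
      inj₂ y , Straddles⇒adjacent s eiy′ ,
      (inj₁ m , (emy , λ { (inj₁ x) → m-least }) , ≤-<-trans (m-least eky) k<i) ,
      (inj₁ M , (eMy , λ { (inj₁ x) → M-greatest }) , <-≤-trans i<j (M-greatest ejy))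

  Below : Pred (Vertex p q) 0ℓ
  Below (inj₁ x) = x <F i
  Below (inj₂ y) = ∃ λ k → k <F i × E k y

  ¬Straddles⇒cut : (∀ {y} → ¬ Straddles y) → ∀ {k j} → k <F i → i <F j → IsCutVertex E (inj₁ i)
  ¬Straddles⇒cut ¬straddles {k} {j} k<i i<j =
    inj₁ k , inj₁ j , <⇒≢ k<i ∘ inj₁-injective , ≢-sym (<⇒≢ i<j ∘ inj₁-injective) ,
    λ path → <-asym i<j (Star-preserves Below step path k<i)
    where
    step : ∀ {s t} → AdjWithout E (inj₁ i) s t → Below s → Below t
    step {inj₁ x} {inj₂ y} (e , _) x<i = x , x<i , e
    step {inj₂ y} {inj₁ x} (e , _ , x≢i) (k′ , k′<i , ek′y) with <-cmp x i
    ... | tri< x<i _ _ = x<i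
    ... | tri≈ _ refl _ = contradiction refl x≢i
    ... | tri> _ _ i<x = contradiction (k′ , x , k′<i , i<x , ek′y , e) ¬straddles

  ¬cut⇔Straddled : Connected E → Decidable E → IsStrongOrdering E → ∀ {k j} → k <F i → i <F j →
                   (¬ IsCutVertex E (inj₁ i)) ⇔ Straddled E (inj₁ i)
  ¬cut⇔Straddled conn E? so k<i i<j = mk⇔ forward backward
    where
    neighbour : ∃ (E i)
    neighbour with Connected⇒neighbour E conn (≢-sym (<⇒≢ k<i ∘ inj₁-injective))
    ... | inj₂ y , e = y , e

    forward : ¬ IsCutVertex E (inj₁ i) → Straddled E (inj₁ i)
    forward ¬cut with any? (Straddles? E?)
    ... | yes (y , s) = Straddles⇒Straddled so E? neighbour s
    ... | no ¬∃ = contradiction (¬Straddles⇒cut (λ s → ¬∃ (_ , s)) k<i i<j) ¬cut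

    backward : Straddled E (inj₁ i) → ¬ IsCutVertex E (inj₁ i)
    backward str with Straddled⇒Straddles str
    ... | y , s = ¬cut-if-neighbours-reachable E conn (inj₁ i) (inj₂ y) (Straddles⇒neighbours-reachable so s)

swap-injective : ∀ {A B : Set} {a b : A ⊎ B} → swap a ≡ swap b → a ≡ b
swap-injective {a = inj₁ _} {inj₁ _} refl = refl
swap-injective {a = inj₂ _} {inj₂ _} refl = refl

swap-≡ : ∀ {A B : Set} {a : A ⊎ B} {b} → swap a ≡ b → a ≡ swap b
swap-≡ {a = a} refl = sym (swap-involutive a)

≤V-swap : ∀ {p q} {a : Vertex p q} {b} → a ≤V swap b → swap a ≤V b
≤V-swap {a = inj₁ _} {inj₂ _} a≤b = a≤b
≤V-swap {a = inj₂ _} {inj₁ _} a≤b = a≤b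

swap-≤V : ∀ {p q} {a : Vertex p q} {b} → swap a ≤V b → a ≤V swap b
swap-≤V {a = inj₁ _} {inj₂ _} a≤b = a≤b
swap-≤V {a = inj₂ _} {inj₁ _} a≤b = a≤b

<V-swap : ∀ {p q} {a b : Vertex p q} → a <V b → swap a <V swap b
<V-swap {a = inj₁ _} {inj₁ _} a<b = a<b
<V-swap {a = inj₂ _} {inj₂ _} a<b = a<b

Adj-flip : ∀ {p q} (E : Fin p → Fin q → Set) {a b} → Adj E a b → Adj (flip E) (swap a) (swap b)
Adj-flip _ {inj₁ _} {inj₂ _} e = e
Adj-flip _ {inj₂ _} {inj₁ _} e = e

Adj-unflip : ∀ {p q} (E : Fin p → Fin q → Set) {a b} → Adj (flip E) (swap a) b → Adj E a (swap b)
Adj-unflip _ {inj₁ _} {inj₁ _} e = e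
Adj-unflip _ {inj₂ _} {inj₂ _} e = e

module _ {p q : ℕ} (E : Fin p → Fin q → Set) where

  Connected-flip : Connected E → Connected (flip E)
  Connected-flip conn v w = subst₂ (Star (Adj (flip E))) (swap-involutive v) (swap-involutive w)
    (gmap swap (λ {a} {b} → Adj-flip E {a} {b}) (conn (swap v) (swap w)))

  IsStrongOrdering-flip : IsStrongOrdering E → IsStrongOrdering (flip E)
  IsStrongOrdering-flip so a a′ b b′ e e′ a<a′ b′<b = so b′ b a′ a e′ e b′<b a<a′

  IsCutVertex-flip : ∀ {u} → IsCutVertex E u → IsCutVertex (flip E) (swap u)
  IsCutVertex-flip {u} (v , w , v≢u , w≢u , ¬path) =
    swap v , swap w , v≢u ∘ swap-injective , w≢u ∘ swap-injective ,
    λ path → ¬path (subst₂ (Star (AdjWithout E u)) (swap-involutive v) (swap-involutive w) (gmap swap unflip path))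
    where
    unflip : ∀ {a b} → AdjWithout (flip E) (swap u) a b → AdjWithout E u (swap a) (swap b)
    unflip {a} {b} (e , a≢u , b≢u) = Adj-flip (flip E) {a} {b} e , a≢u ∘ swap-≡ , b≢u ∘ swap-≡

  Straddled-flip : ∀ {u} → Straddled E u → Straddled (flip E) (swap u)
  Straddled-flip {u} (u₀ , e , (a , (ea , a-first) , a<u) , (b , (eb , b-last) , u<b)) =
    swap u₀ , Adj-flip E {u} e ,
    (swap a , (Adj-flip E {u₀} ea , λ c ec → ≤V-swap {a = a} (a-first (swap c) (Adj-unflip E {u₀} ec))) ,
     <V-swap {a = a} a<u) ,
    (swap b , (Adj-flip E {u₀} eb , λ c ec → swap-≤V {a = c} (b-last (swap c) (Adj-unflip E {u₀} ec))) ,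
     <V-swap {a = u} u<b)

¬cut⇔Straddled-inj₁ : ∀ {p q} (E : Fin p → Fin q → Set) → Connected E → Decidable E → IsStrongOrdering E →
                      (i : Fin p) → IsInterim {p} {q} (inj₁ i) → (¬ IsCutVertex E (inj₁ i)) ⇔ Straddled E (inj₁ i)
¬cut⇔Straddled-inj₁ E conn E? so i interim with interim⇒between i interim
... | (_ , k<i) , (_ , i<j) = XVertex.¬cut⇔Straddled E i conn E? so k<i i<j

mainTheorem6 : (p q : ℕ) (E : Fin p → Fin q → Set) →
    Connected E → IsPermutationGraph E → IsStrongOrdering E →
    (u : Vertex p q) → IsInterim u →
    (¬ IsCutVertex E u) ⇔
      (∃ λ u₀ → _∈N_ E u₀ u × (∃ λ a → IsFirstNbr E u₀ a × a <V u) × (∃ λ b → IsLastNbr E u₀ b × u <V b))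
mainTheorem6 p q E conn perm so (inj₁ i) =
  ¬cut⇔Straddled-inj₁ E conn (IsPermutationGraph⇒Decidable E perm) so i
mainTheorem6 p q E conn perm so (inj₂ j) interim =
  mk⇔ (λ ¬cut → Straddled-flip Eᵀ (to (¬cut ∘ IsCutVertex-flip Eᵀ)))
      (λ str → from (Straddled-flip E str) ∘ IsCutVertex-flip E)
  where
  Eᵀ : Fin q → Fin p → Set
  Eᵀ = flip E
  Eᵀ? : Decidable Eᵀ
  Eᵀ? = flip (IsPermutationGraph⇒Decidable E perm)
  open Equivalence (¬cut⇔Straddled-inj₁ Eᵀ (Connected-flip E conn) Eᵀ? (IsStrongOrdering-flip E so) j interim)
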